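{- Let $G=(A\cup B,E)$ be a bipartite graph that is $r$-regular and $K_{2,s}$-free for some $s\ge2$. Then $\widehat{S}(\mathrm{GAL}_G)\ge 2^{\lfloor (r-1)/(s-1)\rfloor}$.
   Context: $r$-regular: every vertex has degree $r$. $K_{2,s}$-free: $G$ contains no subgraph isomorphic to $K_{2,s}$, i.e. no two distinct vertices have $s$ common neighbours. For $S\subseteq A$, $\mathrm{N}(S)\subseteq B$ is the set of neighbours of $S$. $\mathrm{GAL}_G:\{0,1\}^A\to\{0,1\}$ treats $x$ as a subset of $A$ and is $1$ iff $\mathrm{N}(x)=B$. For $f:\{0,1\}^n\to\{0,1\}$ and $D\subseteq[n]$, $f_D$ is the matrix with rows indexed by $\alpha\in\{0,1\}^D$, columns by assignments to the complement, entry the value of $f$; $\mathsf{mult}(f_D)$ is the number of occurrences of a most frequent row; $\widehat{S}(f)=\max_{1\le k\le n}\min_{|D|=k}2^k/\mathsf{mult}(f_D)$. -}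

module Defs where

open import Data.Bool using (Bool; true; false; not; _∧_; _∨_; _xor_; if_then_else_)
open import Data.Nat using (ℕ; zero; suc; _/_; _⊔_; _≡ᵇ_)
open import Data.Fin using (Fin)
open import Data.Integer using (+_)
open import Data.List using (List; []; _∷_; map; foldr; length; filterᵇ; allFin; upTo; concatMap)
import Data.Vec.Functional as VF
open import Data.Bool.ListAction using (all; any)
open import Data.Rational as ℚ using (ℚ; 0ℚ)
open import Function using (_∘_)

allAssign : (n : ℕ) → List (Fin n → Bool)
allAssign zero = (λ ()) ∷ []
allAssign (suc n) = concatMap (λ g → (false VF.∷ g) ∷ (true VF.∷ g) ∷ []) (allAssign n)

size : {n : ℕ} → (Fin n → Bool) → ℕ
size {n} D = length (filterᵇ D (allFin n))

-- Bipartite graphs G = (A ∪ B, E) with A = Fin a, B = Fin b,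
-- edges given by the Boolean adjacency  adj : Fin a → Fin b → Bool.

degA : {a b : ℕ} → (Fin a → Fin b → Bool) → Fin a → ℕ
degA {b = b} adj u = length (filterᵇ (adj u) (allFin b))

degB : {a b : ℕ} → (Fin a → Fin b → Bool) → Fin b → ℕ
degB {a = a} adj v = length (filterᵇ (λ u → adj u v) (allFin a))

Regular : {a b : ℕ} → (Fin a → Fin b → Bool) → ℕ → Set
Regular adj r = (∀ u → degA adj u ≡ r) × (∀ v → degB adj v ≡ r)
  where open import Relation.Binary.PropositionalEquality using (_≡_)
        open import Data.Product using (_×_)

commonA : {a b : ℕ} → (Fin a → Fin b → Bool) → Fin a → Fin a → ℕ
commonA {b = b} adj u u' = length (filterᵇ (λ v → adj u v ∧ adj u' v) (allFin b))

commonB : {a b : ℕ} → (Fin a → Fin b → Bool) → Fin b → Fin b → ℕ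
commonB {a = a} adj v v' = length (filterᵇ (λ u → adj u v ∧ adj u v') (allFin a))

-- K_{2,s}-free: no two distinct vertices have s common neighbours.
-- (Vertices on different sides of a bipartite graph have no common neighbours.)
K2sFree : {a b : ℕ} → (Fin a → Fin b → Bool) → ℕ → Set
K2sFree adj s =
  (∀ u u' → ¬ (u ≡ u') → commonA adj u u' < s) ×
  (∀ v v' → ¬ (v ≡ v') → commonB adj v v' < s)
  where open import Relation.Binary.PropositionalEquality using (_≡_)
        open import Relation.Nullary using (¬_)
        open import Data.Nat using (_<_)
        open import Data.Product using (_×_)

-- GAL_G(x) = 1 iff N(x) = B  (x ⊆ A given by its indicator)
GAL : {a b : ℕ} → (Fin a → Fin b → Bool) → (Fin a → Bool) → Bool
GAL {a} {b} adj x = all (λ v → any (λ u → x u ∧ adj u v) (allFin a)) (allFin b)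

-- The measure  Ŝ(f) = max_{1≤k≤n} min_{|D|=k} 2^k / mult(f_D)

module _ {n : ℕ} where

  supportedIn : (Fin n → Bool) → (Fin n → Bool) → Bool
  supportedIn D α = all (λ i → D i ∨ not (α i)) (allFin n)

  -- row indices of f_D : assignments α ∈ {0,1}^D
  rows : (Fin n → Bool) → List (Fin n → Bool)
  rows D = filterᵇ (supportedIn D) (allAssign n)

  -- column indices of f_D : assignments to the complement of D
  cols : (Fin n → Bool) → List (Fin n → Bool)
  cols D = filterᵇ (supportedIn (not ∘ D)) (allAssign n)

  merge : (Fin n → Bool) → (Fin n → Bool) → (Fin n → Bool) → (Fin n → Bool)
  merge D α β i = if D i then α i else β i

  sameRow : ((Fin n → Bool) → Bool) → (Fin n → Bool) → (Fin n → Bool) → (Fin n → Bool) → Bool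
  sameRow f D α α' = all (λ β → not (f (merge D α β) xor f (merge D α' β))) (cols D)

  mult : ((Fin n → Bool) → Bool) → (Fin n → Bool) → ℕ
  mult f D = foldr _⊔_ 0 (map (λ α → length (filterᵇ (sameRow f D α) (rows D))) (rows D))

-- p / q as a rational (q = mult(f_D) ≥ 1 always; the q = 0 clause is never used)
frac : ℕ → ℕ → ℚ
frac p zero = 0ℚ
frac p (suc q) = (+ p) ℚ./ suc q

-- min / max of a nonempty list of rationals (the [] clause is never used)
minQ : List ℚ → ℚ
minQ [] = 0ℚ
minQ (x ∷ xs) = foldr ℚ._⊓_ x xs

maxQ : List ℚ → ℚ
maxQ [] = 0ℚ
maxQ (x ∷ xs) = foldr ℚ._⊔_ x xs

Shat : {n : ℕ} → ((Fin n → Bool) → Bool) → ℚ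
Shat {n} f =
  maxQ (map (λ k → minQ (map (λ D → frac (2 Data.Nat.^ k) (mult f D))
                                (filterᵇ (λ D → size D ≡ᵇ k) (allAssign n))))
            (map suc (upTo n)))

-- ⌊ x / y ⌋ on ℕ (used only with y ≥ 1)
floorDiv : ℕ → ℕ → ℕ
floorDiv x zero = 0
floorDiv x (suc y) = x / suc y

-- Let m = s − 1 and t = ⌊(r − 1)/m⌋. If t = 0 the bound is 1, which holds at k = 1 since f_D then
-- has only two rows, so mult ≤ 2. If t ≥ 1 then t·m < r, and we show that for every
-- D ⊆ A with |D| = t all rows of GAL_D are distinct, so the ratio at k = t is 2^t. Take rows α ≠ α'
-- and u ∈ α ∖ α'. Each vertex of α' shares at most m neighbours with u and |α'| ≤ t, so u has a
-- neighbour v outside N(α'). The column β = (A ∖ D) ∖ N(v) separates the rows: α' ∪ β misses v,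
-- while α ∪ β reaches v through u and reaches every other w ∈ B, since at most m neighbours of w lie
-- in N(v) and at most t − 1 lie in D ∖ α, which is less than the degree r of w.
module Submission where

open import Defs
open import Data.Nat using (ℕ; _≤_; _∸_; _^_)
open import Data.Fin using (Fin)
open import Data.Bool using (Bool)
open import Data.Integer using (+_)
open import Data.Rational as ℚ using (ℚ)

open import Data.Nat using (zero; suc; _+_; _*_; _<_; _⊔_; _/_; _≡ᵇ_; z≤n; s≤s; s≤s⁻¹; >-nonZero)
open import Data.Nat.Properties
open import Data.Nat.DivMod using (m/n*n≤m)
open import Data.Fin using (zero; suc) renaming (_≟_ to _≟ᶠ_)
open import Data.Bool using (true; false; not; _∧_; _∨_; _xor_; if_then_else_; T?)
open import Data.Bool.Properties using (∧-zeroʳ; ∧-conicalˡ; ∧-conicalʳ; ∨-zeroʳ; ∨-identityʳ; xor-same; not-injective; not-¬; T-≡)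
open import Data.Bool.ListAction using (all; any; and; or)
open import Data.List using (List; []; _∷_; map; foldr; length; filterᵇ; allFin; concatMap; tabulate)
open import Data.List.Properties using (length-filter; length-tabulate; map-cong; map-tabulate)
open import Data.List.Membership.Propositional using (_∈_)
open import Data.List.Membership.Propositional.Properties using (∈-concat⁺′; ∈-filter⁺; ∈-filter⁻; ∈-allFin; ∈-map⁺; ∈-map⁻; ∈-upTo⁺)
open import Data.List.Relation.Unary.Any using (here; there)
open import Data.Product using (Σ; _×_; _,_; proj₁; proj₂)
import Data.Rational.Properties as ℚP
import Data.Vec.Functional as VF
open import Function using (_∘_; id; Equivalence)
open import Relation.Binary.PropositionalEquality
open import Relation.Nullary using (yes; no)
open import Relation.Nullary.Decidable using (toWitness)
open import Data.Unit using (tt)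
open import Data.Empty using (⊥-elim)

countᵇ : {A : Set} → (A → Bool) → List A → ℕ
countᵇ p xs = length (filterᵇ p xs)

module _ {A : Set} where

  countᵇ-∷ : (p : A → Bool) (x : A) (xs : List A) →
             countᵇ p (x ∷ xs) ≡ (if p x then suc (countᵇ p xs) else countᵇ p xs)
  countᵇ-∷ p x xs with p x
  ... | true  = refl
  ... | false = refl

  countᵇ-mono : (p q : A → Bool) → (∀ x → p x ≡ true → q x ≡ true) →
                ∀ xs → countᵇ p xs ≤ countᵇ q xs
  countᵇ-mono p q p⇒q [] = z≤n
  countᵇ-mono p q p⇒q (x ∷ xs)
    rewrite countᵇ-∷ p x xs | countᵇ-∷ q x xs with p x in px | q x in qx
  ... | true  | true  = s≤s (countᵇ-mono p q p⇒q xs)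
  ... | true  | false with () ← trans (sym (p⇒q x px)) qx
  ... | false | true  = m≤n⇒m≤1+n (countᵇ-mono p q p⇒q xs)
  ... | false | false = countᵇ-mono p q p⇒q xs

  countᵇ-cong : (p q : A → Bool) → p ≗ q → ∀ xs → countᵇ p xs ≡ countᵇ q xs
  countᵇ-cong p q p≗q xs = ≤-antisym (countᵇ-mono p q (λ x e → trans (sym (p≗q x)) e) xs)
                                      (countᵇ-mono q p (λ x e → trans (p≗q x) e) xs)

  countᵇ-none : (p : A → Bool) → (∀ x → p x ≡ false) → ∀ xs → countᵇ p xs ≡ 0
  countᵇ-none p none [] = refl
  countᵇ-none p none (x ∷ xs) rewrite countᵇ-∷ p x xs | none x = countᵇ-none p none xs

  countᵇ-split : (p q : A → Bool) → ∀ xs →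
    countᵇ p xs ≡ countᵇ (λ x → p x ∧ q x) xs + countᵇ (λ x → p x ∧ not (q x)) xs
  countᵇ-split p q [] = refl
  countᵇ-split p q (x ∷ xs)
    rewrite countᵇ-∷ p x xs | countᵇ-∷ (λ x → p x ∧ q x) x xs
          | countᵇ-∷ (λ x → p x ∧ not (q x)) x xs
    with p x | q x
  ... | true  | true  = cong suc (countᵇ-split p q xs)
  ... | true  | false = trans (cong suc (countᵇ-split p q xs)) (sym (+-suc _ _))
  ... | false | _     = countᵇ-split p q xs

  countᵇ-∨ : (p q q' : A → Bool) → ∀ xs →
    countᵇ (λ x → p x ∧ (q x ∨ q' x)) xs ≤ countᵇ (λ x → p x ∧ q x) xs + countᵇ (λ x → p x ∧ q' x) xs
  countᵇ-∨ p q q' xs = begin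
    countᵇ (λ x → p x ∧ (q x ∨ q' x)) xs
      ≡⟨ countᵇ-split (λ x → p x ∧ (q x ∨ q' x)) q xs ⟩
    countᵇ (λ x → (p x ∧ (q x ∨ q' x)) ∧ q x) xs + countᵇ (λ x → (p x ∧ (q x ∨ q' x)) ∧ not (q x)) xs
      ≤⟨ +-mono-≤ (countᵇ-mono _ _ (λ x → in-q (p x) (q x) (q' x)) xs)
                  (countᵇ-mono _ _ (λ x → in-q' (p x) (q x) (q' x)) xs) ⟩
    countᵇ (λ x → p x ∧ q x) xs + countᵇ (λ x → p x ∧ q' x) xs ∎
    where
    open ≤-Reasoning
    in-q : ∀ a b c → (a ∧ (b ∨ c)) ∧ b ≡ true → a ∧ b ≡ true
    in-q true true  _     _  = refl
    in-q true false true  ()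
    in-q true false false ()
    in-q false _    _     ()
    in-q' : ∀ a b c → (a ∧ (b ∨ c)) ∧ not b ≡ true → a ∧ c ≡ true
    in-q' true  false true  _  = refl
    in-q' true  false false ()
    in-q' true  true  _     ()
    in-q' false _     _     ()

  countᵇ-positive : (p : A → Bool) → ∀ {x xs} → x ∈ xs → p x ≡ true → 0 < countᵇ p xs
  countᵇ-positive p {x} {.x ∷ xs} (here refl) px rewrite countᵇ-∷ p x xs | px = s≤s z≤n
  countᵇ-positive p {x} {y ∷ xs} (there x∈xs) px rewrite countᵇ-∷ p y xs with p y
  ... | true  = s≤s z≤n
  ... | false = countᵇ-positive p x∈xs px

  countᵇ-witness : (p : A → Bool) → ∀ xs → 0 < countᵇ p xs → Σ A λ x → p x ≡ true
  countᵇ-witness p (x ∷ xs) pos rewrite countᵇ-∷ p x xs with p x in px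
  ... | true  = x , px
  ... | false = countᵇ-witness p xs pos

  countᵇ-outside : (p q : A → Bool) → ∀ xs → countᵇ (λ x → p x ∧ q x) xs < countᵇ p xs →
                   Σ A λ x → p x ∧ not (q x) ≡ true
  countᵇ-outside p q xs lt = countᵇ-witness _ xs
    (+-cancelˡ-< c 0 _ (subst₂ _<_ (sym (+-identityʳ c)) (countᵇ-split p q xs) lt))
    where c = countᵇ (λ x → p x ∧ q x) xs

  countᵇ-remove : (p q : A → Bool) → ∀ {x xs} → x ∈ xs → p x ≡ true → q x ≡ true →
                  countᵇ (λ y → p y ∧ not (q y)) xs < countᵇ p xs
  countᵇ-remove p q {x} {xs} x∈xs px qx = begin-strict
    countᵇ (λ y → p y ∧ not (q y)) xs
      <⟨ m<n+m _ (countᵇ-positive (λ y → p y ∧ q y) x∈xs (cong₂ _∧_ px qx)) ⟩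
    countᵇ (λ y → p y ∧ q y) xs + countᵇ (λ y → p y ∧ not (q y)) xs
      ≡⟨ countᵇ-split p q xs ⟨
    countᵇ p xs ∎
    where open ≤-Reasoning

  countᵇ-filterᵇ : (p q : A → Bool) → ∀ xs → countᵇ q (filterᵇ p xs) ≡ countᵇ (λ x → p x ∧ q x) xs
  countᵇ-filterᵇ p q [] = refl
  countᵇ-filterᵇ p q (x ∷ xs) rewrite countᵇ-∷ (λ x → p x ∧ q x) x xs with p x
  ... | false = countᵇ-filterᵇ p q xs
  ... | true rewrite countᵇ-∷ q x (filterᵇ p xs) with q x
  ...   | true  = cong suc (countᵇ-filterᵇ p q xs)
  ...   | false = countᵇ-filterᵇ p q xs

  all-true⁻ : (p : A → Bool) → ∀ {x} xs → all p xs ≡ true → x ∈ xs → p x ≡ true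
  all-true⁻ p (y ∷ xs) all≡true (here refl) with p y | all≡true
  ... | true | _ = refl
  all-true⁻ p (y ∷ xs) all≡true (there x∈xs) with p y | all≡true
  ... | true | rest = all-true⁻ p xs rest x∈xs

  all-true⁺ : (p : A → Bool) → ∀ xs → (∀ x → x ∈ xs → p x ≡ true) → all p xs ≡ true
  all-true⁺ p [] _ = refl
  all-true⁺ p (y ∷ xs) every rewrite every y (here refl) = all-true⁺ p xs (λ x → every x ∘ there)

  all-false⁺ : (p : A → Bool) → ∀ {x} xs → x ∈ xs → p x ≡ false → all p xs ≡ false
  all-false⁺ p (y ∷ xs) (here refl) px rewrite px = refl
  all-false⁺ p (y ∷ xs) (there x∈xs) px with p y
  ... | true  = all-false⁺ p xs x∈xs px
  ... | false = refl

  any-true⁺ : (p : A → Bool) → ∀ {x} xs → x ∈ xs → p x ≡ true → any p xs ≡ true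
  any-true⁺ p (y ∷ xs) (here refl) px rewrite px = refl
  any-true⁺ p (y ∷ xs) (there x∈xs) px with p y
  ... | true  = refl
  ... | false = any-true⁺ p xs x∈xs px

  any-false⁺ : (p : A → Bool) → ∀ xs → (∀ x → p x ≡ false) → any p xs ≡ false
  any-false⁺ p [] _ = refl
  any-false⁺ p (y ∷ xs) none rewrite none y = any-false⁺ p xs none

  any-false⁻ : (p : A → Bool) → ∀ {x} xs → any p xs ≡ false → x ∈ xs → p x ≡ false
  any-false⁻ p (y ∷ xs) any≡false (here refl) with p y | any≡false
  ... | false | _ = refl
  any-false⁻ p (y ∷ xs) any≡false (there x∈xs) with p y | any≡false
  ... | false | rest = any-false⁻ p xs rest x∈xs

  ∈-filterᵇ⁻ : (p : A → Bool) → ∀ {x} xs → x ∈ filterᵇ p xs → p x ≡ true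
  ∈-filterᵇ⁻ p xs x∈ = Equivalence.to T-≡ (proj₂ (∈-filter⁻ (T? ∘ p) {xs = xs} x∈))

  ∈-filterᵇ⁺ : (p : A → Bool) → ∀ {x} xs → x ∈ xs → p x ≡ true → x ∈ filterᵇ p xs
  ∈-filterᵇ⁺ p xs x∈ px = ∈-filter⁺ (T? ∘ p) x∈ (Equivalence.from T-≡ px)

  foldr-⊔-lub : (F : A → ℕ) {k : ℕ} → ∀ xs → (∀ x → x ∈ xs → F x ≤ k) → foldr _⊔_ 0 (map F xs) ≤ k
  foldr-⊔-lub F [] _ = z≤n
  foldr-⊔-lub F (y ∷ xs) bound = ⊔-lub (bound y (here refl)) (foldr-⊔-lub F xs (λ x → bound x ∘ there))

  foldr-⊔-upper : (F : A → ℕ) → ∀ {x} xs → x ∈ xs → F x ≤ foldr _⊔_ 0 (map F xs)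
  foldr-⊔-upper F (y ∷ xs) (here refl)  = m≤m⊔n _ _
  foldr-⊔-upper F (y ∷ xs) (there x∈xs) = ≤-trans (foldr-⊔-upper F xs x∈xs) (m≤n⊔m _ _)

countᵇ-map : {A B : Set} (p : B → Bool) (f : A → B) → ∀ xs → countᵇ p (map f xs) ≡ countᵇ (p ∘ f) xs
countᵇ-map p f [] = refl
countᵇ-map p f (x ∷ xs) rewrite countᵇ-∷ p (f x) (map f xs) | countᵇ-∷ (p ∘ f) x xs with p (f x)
... | true  = cong suc (countᵇ-map p f xs)
... | false = countᵇ-map p f xs

countᵇ-any-≤ : {A B : Set} (P : B → Bool) (R : A → B → Bool) (S : A → Bool) (ys : List B) {m : ℕ} →
  (∀ x → S x ≡ true → countᵇ (λ y → P y ∧ R x y) ys ≤ m) →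
  ∀ xs → countᵇ (λ y → P y ∧ any (λ x → S x ∧ R x y) xs) ys ≤ countᵇ S xs * m
countᵇ-any-≤ P R S ys bound [] =
  ≤-reflexive (countᵇ-none _ (λ y → ∧-zeroʳ (P y)) ys)
countᵇ-any-≤ P R S ys {m} bound (x ∷ xs) = ≤-trans
  (countᵇ-∨ P (λ y → S x ∧ R x y) (λ y → any (λ x → S x ∧ R x y) xs) ys)
  (head+tail (S x) refl)
  where
  tail = countᵇ-any-≤ P R S ys bound xs
  head+tail : ∀ s → S x ≡ s →
    countᵇ (λ y → P y ∧ (S x ∧ R x y)) ys + countᵇ (λ y → P y ∧ any (λ x → S x ∧ R x y) xs) ys
      ≤ countᵇ S (x ∷ xs) * m
  head+tail true  Sx rewrite countᵇ-∷ S x xs | Sx = +-mono-≤ (bound x Sx) tail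
  head+tail false Sx rewrite countᵇ-∷ S x xs | Sx
    rewrite countᵇ-none _ (λ y → ∧-zeroʳ (P y)) ys = tail

all-cong : {A : Set} {p q : A → Bool} → p ≗ q → ∀ xs → all p xs ≡ all q xs
all-cong p≗q xs = cong and (map-cong p≗q xs)

any-cong : {A : Set} {p q : A → Bool} → p ≗ q → ∀ xs → any p xs ≡ any q xs
any-cong p≗q xs = cong or (map-cong p≗q xs)

size-suc : ∀ {n} (D : Fin (suc n) → Bool) →
  size D ≡ (if D zero then suc (size (D ∘ suc)) else size (D ∘ suc))
size-suc {n} D = trans (countᵇ-∷ D zero (tabulate suc))
  (cong (λ k → if D zero then suc k else k)
        (trans (cong (countᵇ D) (sym (map-tabulate id suc))) (countᵇ-map D suc (allFin n))))

initialSegment : ∀ n → ℕ → Fin n → Bool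
initialSegment zero    k       = λ ()
initialSegment (suc n) zero    = false VF.∷ initialSegment n zero
initialSegment (suc n) (suc k) = true  VF.∷ initialSegment n k

size-initialSegment : ∀ n k → k ≤ n → size (initialSegment n k) ≡ k
size-initialSegment zero    zero    _         = refl
size-initialSegment (suc n) zero    _         =
  trans (size-suc (initialSegment (suc n) zero)) (size-initialSegment n zero z≤n)
size-initialSegment (suc n) (suc k) (s≤s k≤n) =
  trans (size-suc (initialSegment (suc n) (suc k))) (cong suc (size-initialSegment n k k≤n))

extensions : ∀ {n} → (Fin n → Bool) → List (Fin (suc n) → Bool)
extensions g = (false VF.∷ g) ∷ (true VF.∷ g) ∷ []

-- allAssign lists each assignment as a pointwise-equal copy; there is no function extensionality.
allAssign-complete : ∀ n (g : Fin n → Bool) → Σ (Fin n → Bool) λ g' → g' ∈ allAssign n × g' ≗ g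
allAssign-complete zero g = (λ ()) , here refl , λ ()
allAssign-complete (suc n) g with allAssign-complete n (g ∘ suc)
... | g' , g'∈ , g'≗ =
  g zero VF.∷ g' , ∈-concat⁺′ head∈ (∈-map⁺ extensions g'∈) , tail≗
  where
  head∈ : g zero VF.∷ g' ∈ extensions g'
  head∈ with g zero
  ... | false = here refl
  ... | true  = there (here refl)
  tail≗ : g zero VF.∷ g' ≗ g
  tail≗ zero    = refl
  tail≗ (suc i) = g'≗ i

countᵇ-extend : ∀ {n} (Q : (Fin (suc n) → Bool) → Bool) (gs : List (Fin n → Bool)) →
  countᵇ Q (concatMap extensions gs)
    ≡ countᵇ (λ g → Q (false VF.∷ g)) gs + countᵇ (λ g → Q (true VF.∷ g)) gs
countᵇ-extend Q [] = refl
countᵇ-extend Q (g ∷ gs)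
  rewrite countᵇ-∷ Q (false VF.∷ g) ((true VF.∷ g) ∷ concatMap extensions gs)
        | countᵇ-∷ Q (true VF.∷ g) (concatMap extensions gs)
        | countᵇ-∷ (λ g → Q (false VF.∷ g)) g gs | countᵇ-∷ (λ g → Q (true VF.∷ g)) g gs
  with Q (false VF.∷ g) | Q (true VF.∷ g)
... | true  | true  = cong suc (trans (cong suc (countᵇ-extend Q gs)) (sym (+-suc _ _)))
... | true  | false = cong suc (countᵇ-extend Q gs)
... | false | true  = trans (cong suc (countᵇ-extend Q gs)) (sym (+-suc _ _))
... | false | false = countᵇ-extend Q gs

-- Assignments that agree with c outside D are determined by their values on D.
countᵇ-allAssign≤2^size : ∀ n (D c : Fin n → Bool) (Q : (Fin n → Bool) → Bool) →
  (∀ g → Q g ≡ true → ∀ i → D i ≡ false → g i ≡ c i) →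
  countᵇ Q (allAssign n) ≤ 2 ^ size D
countᵇ-allAssign≤2^size zero D c Q _ = length-filter (T? ∘ Q) (allAssign zero)
countᵇ-allAssign≤2^size (suc n) D c Q fixed =
  subst (λ k → countᵇ Q (allAssign (suc n)) ≤ 2 ^ k) (sym (size-suc D))
    (subst (_≤ _) (sym (countᵇ-extend Q (allAssign n))) (branches (D zero) refl))
  where
  branch : Bool → ℕ
  branch x = countᵇ (λ g → Q (x VF.∷ g)) (allAssign n)
  branch≤ : ∀ x → branch x ≤ 2 ^ size (D ∘ suc)
  branch≤ x = countᵇ-allAssign≤2^size n (D ∘ suc) (c ∘ suc) _ (λ g e i → fixed _ e (suc i))
  branch≡0 : ∀ x → D zero ≡ false → c zero ≡ not x → branch x ≡ 0
  branch≡0 x D₀ c₀ = countᵇ-none _ empty (allAssign n)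
    where
    empty : ∀ g → Q (x VF.∷ g) ≡ false
    empty g with Q (x VF.∷ g) in Qg
    ... | false = refl
    ... | true  = ⊥-elim (not-¬ refl (trans (fixed _ Qg zero D₀) c₀))
  branches : ∀ d → D zero ≡ d →
    branch false + branch true ≤ 2 ^ (if d then suc (size (D ∘ suc)) else size (D ∘ suc))
  branches true _ = +-mono-≤ (branch≤ false) (≤-trans (branch≤ true) (m≤m+n _ 0))
  branches false D₀ with c zero in c₀
  ... | false = ≤-trans (≤-reflexive (trans (cong (λ k → branch false + k) (branch≡0 true D₀ c₀)) (+-identityʳ _)))
                        (branch≤ false)
  ... | true  = ≤-trans (≤-reflexive (cong (_+ branch true) (branch≡0 false D₀ c₀))) (branch≤ true)

module _ {n : ℕ} where

  supportedIn⁻ : ∀ {D α : Fin n → Bool} → supportedIn D α ≡ true → ∀ i → α i ≡ true → D i ≡ true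
  supportedIn⁻ {D} {α} supp i αi with all-true⁻ (λ i → D i ∨ not (α i)) (allFin n) supp (∈-allFin i)
  ... | Di∨ rewrite αi | ∨-identityʳ (D i) = Di∨

  supportedIn⁺ : ∀ {D α : Fin n → Bool} → (∀ i → α i ≡ true → D i ≡ true) → supportedIn D α ≡ true
  supportedIn⁺ {D} {α} α⊆D = all-true⁺ _ (allFin n) (λ i _ → pointwise i (α i) refl)
    where
    pointwise : ∀ i b → α i ≡ b → D i ∨ not b ≡ true
    pointwise i true  αi rewrite α⊆D i αi = refl
    pointwise i false _  = ∨-zeroʳ (D i)

  supported-representative : ∀ {D α : Fin n → Bool} → (∀ i → α i ≡ true → D i ≡ true) →
    Σ (Fin n → Bool) λ α' → α' ∈ filterᵇ (supportedIn D) (allAssign n) × α' ≗ α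
  supported-representative {D} {α} α⊆D with allAssign-complete n α
  ... | α' , α'∈ , α'≗α = α' , ∈-filterᵇ⁺ _ (allAssign n) α'∈ (supportedIn⁺ α'⊆D) , α'≗α
    where
    α'⊆D : ∀ i → α' i ≡ true → D i ≡ true
    α'⊆D i α'i = α⊆D i (trans (sym (α'≗α i)) α'i)

module _ {n : ℕ} (f : (Fin n → Bool) → Bool) (D : Fin n → Bool) where

  mult-positive : 1 ≤ mult f D
  mult-positive with supported-representative {D = D} {α = λ _ → false} (λ _ ())
  ... | z , z∈rows , _ = ≤-trans (countᵇ-positive (sameRow f D z) z∈rows z≈z)
                                 (foldr-⊔-upper _ (rows D) z∈rows)
    where
    z≈z : sameRow f D z z ≡ true
    z≈z = all-true⁺ _ (cols D) (λ β _ → cong not (xor-same (f (merge D z β))))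

  mult≤2^size : mult f D ≤ 2 ^ size D
  mult≤2^size = ≤-trans (foldr-⊔-lub _ (rows D) (λ α _ → length-filter _ (rows D)))
    (countᵇ-allAssign≤2^size n D (λ _ → false) (supportedIn D) (λ α supp i Di → outside α supp i Di))
    where
    outside : ∀ α → supportedIn D α ≡ true → ∀ i → D i ≡ false → α i ≡ false
    outside α supp i Di with α i in αi
    ... | false = refl
    ... | true  = ⊥-elim (not-¬ refl (trans (sym Di) (supportedIn⁻ {D = D} {α = α} supp i αi)))

  mult≤1 : (∀ {α α'} → supportedIn D α ≡ true → supportedIn D α' ≡ true →
            sameRow f D α α' ≡ true → α' ≗ α) →
           mult f D ≤ 1
  mult≤1 rows-distinct = foldr-⊔-lub _ (rows D) bound
    where
    bound : ∀ α → α ∈ rows D → countᵇ (sameRow f D α) (rows D) ≤ 1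
    bound α α∈ = begin
      countᵇ (sameRow f D α) (rows D)
        ≡⟨ countᵇ-filterᵇ (supportedIn D) (sameRow f D α) (allAssign n) ⟩
      countᵇ (λ α' → supportedIn D α' ∧ sameRow f D α α') (allAssign n)
        ≤⟨ countᵇ-allAssign≤2^size n (λ _ → false) α _ (λ α' e i _ → equal α' e i) ⟩
      2 ^ size {n} (λ _ → false)
        ≡⟨ cong (2 ^_) (countᵇ-none (λ _ → false) (λ _ → refl) (allFin n)) ⟩
      1 ∎
      where
      open ≤-Reasoning
      equal : ∀ α' → supportedIn D α' ∧ sameRow f D α α' ≡ true → α' ≗ α
      equal α' e = rows-distinct (∈-filterᵇ⁻ _ (allAssign n) α∈)
        (∧-conicalˡ (supportedIn D α') _ e) (∧-conicalʳ (supportedIn D α') _ e)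

  sameRow-false : (∀ {x y} → x ≗ y → f x ≡ f y) → ∀ {α α' β} →
    supportedIn (not ∘ D) β ≡ true → f (merge D α β) xor f (merge D α' β) ≡ true →
    sameRow f D α α' ≡ false
  sameRow-false f-cong {α} {α'} {β} supp differ
    with supported-representative {D = not ∘ D} {α = β} (supportedIn⁻ supp)
  ... | β' , β'∈cols , β'≗β = all-false⁺ _ (cols D) β'∈cols (cong not (trans
    (cong₂ _xor_ (f-cong (λ i → cong (if D i then α i else_) (β'≗β i)))
                 (f-cong (λ i → cong (if D i then α' i else_) (β'≗β i))))
    differ))

≤-maxQ : ∀ {y z} xs → z ∈ xs → y ℚ.≤ z → y ℚ.≤ maxQ xs
≤-maxQ (x ∷ xs) (here refl)  y≤x = ℚP.≤-trans y≤x (≤-foldr x xs)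
  where
  ≤-foldr : ∀ x ws → x ℚ.≤ foldr ℚ._⊔_ x ws
  ≤-foldr x []       = ℚP.≤-refl
  ≤-foldr x (w ∷ ws) = ℚP.≤-trans (≤-foldr x ws) (ℚP.p≤q⊔p w _)
≤-maxQ (x ∷ xs) (there z∈xs) y≤z = ℚP.≤-trans y≤z (member≤ xs z∈xs)
  where
  member≤ : ∀ {z} ws → z ∈ ws → z ℚ.≤ foldr ℚ._⊔_ x ws
  member≤ (w ∷ ws) (here refl)  = ℚP.p≤p⊔q w _
  member≤ (w ∷ ws) (there z∈ws) = ℚP.≤-trans (member≤ ws z∈ws) (ℚP.p≤q⊔p w _)

≤-minQ : ∀ {y z} xs → z ∈ xs → (∀ w → w ∈ xs → y ℚ.≤ w) → y ℚ.≤ minQ xs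
≤-minQ (x ∷ xs) _ lower = ≤-foldr xs (lower x (here refl)) (λ w → lower w ∘ there)
  where
  ≤-foldr : ∀ {y x} ws → y ℚ.≤ x → (∀ w → w ∈ ws → y ℚ.≤ w) → y ℚ.≤ foldr ℚ._⊓_ x ws
  ≤-foldr []       y≤x _     = y≤x
  ≤-foldr (w ∷ ws) y≤x lower = ℚP.⊓-glb (lower w (here refl)) (≤-foldr ws y≤x (λ v → lower v ∘ there))

subset-of-size : ∀ n k → k ≤ n → Σ (Fin n → Bool) λ D → D ∈ allAssign n × size D ≡ k
subset-of-size n k k≤n with allAssign-complete n (initialSegment n k)
... | D , D∈ , D≗ = D , D∈ , trans (countᵇ-cong _ _ D≗ (allFin n)) (size-initialSegment n k k≤n)

Shat-≥ : ∀ {n} (f : (Fin n → Bool) → Bool) k {y : ℚ} → 1 ≤ k → k ≤ n →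
  (∀ D → size D ≡ k → y ℚ.≤ frac (2 ^ k) (mult f D)) → y ℚ.≤ Shat f
Shat-≥ {n} f k@(suc _) {y} _ k≤n ratio≥ with subset-of-size n k k≤n
... | D₀ , D₀∈ , size-D₀ =
  ≤-maxQ _ (∈-map⁺ min-ratio (∈-map⁺ suc (∈-upTo⁺ k≤n)))
    (≤-minQ _ (∈-map⁺ (ratio k) (∈-filterᵇ⁺ _ (allAssign n) D₀∈ (Equivalence.to T-≡ (≡⇒≡ᵇ _ _ size-D₀))))
       ratio-lower)
  where
  ratio : ℕ → (Fin n → Bool) → ℚ
  ratio j D = frac (2 ^ j) (mult f D)
  of-size : ℕ → List (Fin n → Bool)
  of-size j = filterᵇ (λ D → size D ≡ᵇ j) (allAssign n)
  min-ratio : ℕ → ℚ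
  min-ratio j = minQ (map (ratio j) (of-size j))
  ratio-lower : ∀ w → w ∈ map (ratio k) (of-size k) → y ℚ.≤ w
  ratio-lower w w∈ with ∈-map⁻ (ratio k) w∈
  ... | D , D∈ , refl = ratio≥ D (≡ᵇ⇒≡ _ _ (Equivalence.from T-≡ (∈-filterᵇ⁻ _ (allAssign n) D∈)))

Shat≥1 : ∀ {n} (f : (Fin n → Bool) → Bool) → 1 ≤ n → (+ 1) ℚ./ 1 ℚ.≤ Shat f
Shat≥1 f 1≤n = Shat-≥ f 1 ≤-refl 1≤n (λ D size≡1 →
  1≤2/q (mult-positive f D) (subst (λ k → mult f D ≤ 2 ^ k) size≡1 (mult≤2^size f D)))
  where
  1≤2/q : ∀ {q} → 1 ≤ q → q ≤ 2 → (+ 1) ℚ./ 1 ℚ.≤ frac 2 q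
  1≤2/q {1} _ _ = toWitness {a? = (+ 1) ℚ./ 1 ℚ.≤? (+ 2) ℚ./ 1} tt
  1≤2/q {2} _ _ = ℚP.≤-refl
  1≤2/q {suc (suc (suc _))} _ (s≤s (s≤s ()))

c<d⇒d*m<r⇒c+m<r : ∀ {c d m r} → c < d → 1 ≤ m → d * m < r → c + m < r
c<d⇒d*m<r⇒c+m<r {c} {d} {m} {r} c<d 1≤m d*m<r = begin-strict
  c + m       ≡⟨ +-comm c m ⟩
  m + c       ≤⟨ +-monoʳ-≤ m (m≤m*n c m ⦃ >-nonZero 1≤m ⦄) ⟩
  suc c * m   ≤⟨ *-monoˡ-≤ m c<d ⟩
  d * m       <⟨ d*m<r ⟩
  r           ∎
  where open ≤-Reasoning

regular⇒r≤a : ∀ {a b r} (adj : Fin a → Fin b → Bool) → 1 ≤ a → Regular adj r → r ≤ a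
regular⇒r≤a {suc _} {zero}  adj _ (degA≡r , _) = subst (_≤ _) (degA≡r zero) z≤n
regular⇒r≤a {a}     {suc _} adj _ (_ , degB≡r) =
  subst (_≤ a) (degB≡r zero) (≤-trans (length-filter _ (allFin a)) (≤-reflexive (length-tabulate id)))

module GALRows {a b : ℕ} (adj : Fin a → Fin b → Bool) {r m : ℕ}
               (regular : Regular adj r) (free : K2sFree adj (suc m)) where

  covers : (Fin a → Bool) → Fin b → Bool
  covers x v = any (λ u → x u ∧ adj u v) (allFin a)

  GAL-cong : ∀ {x y} → x ≗ y → GAL adj x ≡ GAL adj y
  GAL-cong x≗y = all-cong (λ v → any-cong (λ u → cong (_∧ adj u v) (x≗y u)) (allFin a)) (allFin b)

  private-neighbour : ∀ u (S : Fin a → Bool) → S u ≡ false → countᵇ S (allFin a) * m < r →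
                      Σ (Fin b) λ v → adj u v ∧ not (covers S v) ≡ true
  private-neighbour u S Su |S|*m<r = countᵇ-outside (adj u) (covers S) (allFin b) (begin-strict
    countᵇ (λ v → adj u v ∧ covers S v) (allFin b)
      ≤⟨ countᵇ-any-≤ (adj u) adj S (allFin b) common≤m (allFin a) ⟩
    countᵇ S (allFin a) * m
      <⟨ |S|*m<r ⟩
    r
      ≡⟨ proj₁ regular u ⟨
    degA adj u ∎)
    where
    open ≤-Reasoning
    common≤m : ∀ w → S w ≡ true → commonA adj u w ≤ m
    common≤m w Sw = s≤s⁻¹ (proj₁ free u w u≢w)
      where
      u≢w : u ≢ w
      u≢w refl with () ← trans (sym Su) Sw

  avoiding : (Fin a → Bool) → Fin b → Fin a → Bool
  avoiding D v x = not (D x) ∧ not (adj x v)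

  -- w has r neighbours: at most m are adjacent to v, at most |D ∖ α| lie in D ∖ α, and any
  -- other one belongs to α or to the column avoiding D v.
  covers-merge-avoiding : ∀ (D α : Fin a → Bool) {v w} → w ≢ v →
    countᵇ (λ x → D x ∧ not (α x)) (allFin a) + m < r →
    covers (merge D α (avoiding D v)) w ≡ true
  covers-merge-avoiding D α {v} {w} w≢v small =
    let x , x-good = countᵇ-outside (λ x → adj x w) (λ x → adj x v ∨ (D x ∧ not (α x))) (allFin a) few
    in any-true⁺ _ (allFin a) (∈-allFin x) (in-merge (D x) (α x) (adj x v) (adj x w) x-good)
    where
    open ≤-Reasoning
    few : countᵇ (λ x → adj x w ∧ (adj x v ∨ (D x ∧ not (α x)))) (allFin a) < degB adj w
    few = begin-strict
      countᵇ (λ x → adj x w ∧ (adj x v ∨ (D x ∧ not (α x)))) (allFin a)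
        ≤⟨ countᵇ-∨ (λ x → adj x w) (λ x → adj x v) (λ x → D x ∧ not (α x)) (allFin a) ⟩
      commonB adj w v + countᵇ (λ x → adj x w ∧ (D x ∧ not (α x))) (allFin a)
        ≤⟨ +-mono-≤ (s≤s⁻¹ (proj₂ free w v w≢v))
                    (countᵇ-mono _ _ (λ x e → ∧-conicalʳ (adj x w) _ e) (allFin a)) ⟩
      m + countᵇ (λ x → D x ∧ not (α x)) (allFin a)
        ≡⟨ +-comm m _ ⟩
      countᵇ (λ x → D x ∧ not (α x)) (allFin a) + m
        <⟨ small ⟩
      r
        ≡⟨ proj₂ regular w ⟨
      degB adj w ∎
    in-merge : ∀ d s av aw → aw ∧ not (av ∨ (d ∧ not s)) ≡ true →
               (if d then s else (not d ∧ not av)) ∧ aw ≡ true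
    in-merge true  true  false true  _  = refl
    in-merge false _     false true  _  = refl
    in-merge true  false false true  ()
    in-merge _     _     true  true  ()
    in-merge _     _     _     false ()

  misses-merge-avoiding : ∀ (D S : Fin a → Bool) {v} → covers S v ≡ false →
    covers (merge D S (avoiding D v)) v ≡ false
  misses-merge-avoiding D S {v} S-misses-v = any-false⁺ _ (allFin a) λ x →
    out-merge (D x) (S x) (adj x v) (any-false⁻ _ (allFin a) S-misses-v (∈-allFin x))
    where
    out-merge : ∀ d s av → s ∧ av ≡ false → (if d then s else (not d ∧ not av)) ∧ av ≡ false
    out-merge true  _ _     s∧av = s∧av
    out-merge false _ false _    = refl
    out-merge false _ true  _    = refl

  separating-column : ∀ {D α α' u} → 1 ≤ m → size D * m < r →
    supportedIn D α ≡ true → supportedIn D α' ≡ true → α u ≡ true → α' u ≡ false →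
    Σ (Fin a → Bool) λ β → supportedIn (not ∘ D) β ≡ true ×
                           GAL adj (merge D α β) ≡ true × GAL adj (merge D α' β) ≡ false
  separating-column {D} {α} {α'} {u} 1≤m |D|*m<r α⊆D α'⊆D αu α'u =
    avoiding D v ,
    supportedIn⁺ (λ i e → ∧-conicalˡ (not (D i)) _ e) ,
    all-true⁺ _ (allFin b) (λ w _ → covered w) ,
    all-false⁺ _ (allFin b) (∈-allFin v) (misses-merge-avoiding D α' α'-misses-v)
    where
    open ≤-Reasoning
    Du : D u ≡ true
    Du = supportedIn⁻ {D = D} {α = α} α⊆D u αu
    private-v : Σ (Fin b) λ v → adj u v ∧ not (covers α' v) ≡ true
    private-v = private-neighbour u α' α'u (begin-strict
      countᵇ α' (allFin a) * m ≤⟨ *-monoˡ-≤ m (countᵇ-mono α' D (supportedIn⁻ α'⊆D) (allFin a)) ⟩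
      size D * m               <⟨ |D|*m<r ⟩
      r                        ∎)
    v = proj₁ private-v
    adj-uv : adj u v ≡ true
    adj-uv = ∧-conicalˡ (adj u v) _ (proj₂ private-v)
    α'-misses-v : covers α' v ≡ false
    α'-misses-v = not-injective (∧-conicalʳ (adj u v) _ (proj₂ private-v))
    D∖α+m<r : countᵇ (λ x → D x ∧ not (α x)) (allFin a) + m < r
    D∖α+m<r = c<d⇒d*m<r⇒c+m<r (countᵇ-remove D α (∈-allFin u) Du αu) 1≤m |D|*m<r
    covered : ∀ w → covers (merge D α (avoiding D v)) w ≡ true
    covered w with w ≟ᶠ v
    ... | yes refl = any-true⁺ _ (allFin a) (∈-allFin u)
                       (cong₂ _∧_ (trans (cong (λ d → if d then α u else avoiding D v u) Du) αu) adj-uv)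
    ... | no w≢v   = covers-merge-avoiding D α w≢v D∖α+m<r

  sameRow-GAL⇒≗ : ∀ {D α α'} → 1 ≤ m → size D * m < r →
    supportedIn D α ≡ true → supportedIn D α' ≡ true → sameRow (GAL adj) D α α' ≡ true → α' ≗ α
  sameRow-GAL⇒≗ {D} {α} {α'} 1≤m small α⊆D α'⊆D same i with α i in αi | α' i in α'i
  ... | true  | true  = refl
  ... | false | false = refl
  ... | true  | false with separating-column 1≤m small α⊆D α'⊆D αi α'i
  ...   | β , β⊆∁D , hit , miss
          with () ← trans (sym same) (sameRow-false (GAL adj) D GAL-cong β⊆∁D (cong₂ _xor_ hit miss))
  sameRow-GAL⇒≗ {D} {α} {α'} 1≤m small α⊆D α'⊆D same i | false | true
    with separating-column 1≤m small α'⊆D α⊆D α'i αi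
  ...   | β , β⊆∁D , hit , miss
          with () ← trans (sym same) (sameRow-false (GAL adj) D GAL-cong β⊆∁D (cong₂ _xor_ miss hit))

  Shat-GAL≥2^ : ∀ {t} → 1 ≤ t → 1 ≤ a → 1 ≤ m → t * m < r → (+ (2 ^ t)) ℚ./ 1 ℚ.≤ Shat (GAL adj)
  Shat-GAL≥2^ {t} 1≤t 1≤a 1≤m t*m<r = Shat-≥ (GAL adj) t 1≤t t≤a λ D size≡t →
    subst (λ q → (+ (2 ^ t)) ℚ./ 1 ℚ.≤ frac (2 ^ t) q) (sym (mult≡1 D size≡t)) ℚP.≤-refl
    where
    t≤a : t ≤ a
    t≤a = ≤-trans (<⇒≤ (≤-<-trans (m≤m*n t m ⦃ >-nonZero 1≤m ⦄) t*m<r)) (regular⇒r≤a adj 1≤a regular)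
    mult≡1 : ∀ D → size D ≡ t → mult (GAL adj) D ≡ 1
    mult≡1 D size≡t = ≤-antisym
      (mult≤1 (GAL adj) D (sameRow-GAL⇒≗ 1≤m (subst (λ k → k * m < r) (sym size≡t) t*m<r)))
      (mult-positive (GAL adj) D)

theorem6p4 : (a b r s : ℕ) (adj : Fin a → Fin b → Bool) →
    1 ≤ a → 2 ≤ s → Regular adj r → K2sFree adj s →
    (+ (2 ^ floorDiv (r ∸ 1) (s ∸ 1))) ℚ./ 1 ℚ.≤ Shat (GAL adj)
theorem6p4 _ _ _       (suc zero)    _   _   (s≤s ()) _ _
theorem6p4 a b zero    (suc (suc m)) adj 1≤a _ _       _    = Shat≥1 (GAL adj) 1≤a
theorem6p4 a b (suc r) (suc (suc m)) adj 1≤a _ regular free = GAL-bound (r / suc m) (m/n*n≤m r (suc m))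
  where
  GAL-bound : ∀ t → t * suc m ≤ r → (+ (2 ^ t)) ℚ./ 1 ℚ.≤ Shat (GAL adj)
  GAL-bound zero    _      = Shat≥1 (GAL adj) 1≤a
  GAL-bound (suc t) t*m≤r = GALRows.Shat-GAL≥2^ adj regular free {suc t} (s≤s z≤n) 1≤a (s≤s z≤n) (s≤s t*m≤r)
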